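{- Let $G=(V,E)$, $V=V_1\cup V_2$, $V_1\cap V_2=\emptyset$, be a design graph with parameters $(m,d,c)$, where $V_1,V_2$ are the two parts of the bipartition. Let $v$ be a vertex in $V_1$. Then the partition $$\pi_2=\{O_1=\{v\},\ O_2=V_1\setminus O_1,\ O_3=N(v),\ O_4=V_2\setminus O_3\},$$ where $N(v)$ is the set of neighbors of $v$, is a distance equitable partition of $V$, and the following matrix $P=(p_{ij})_{4\times 4}$ (rows and columns indexed by $O_1,O_2,O_3,O_4$ in this order) is the quotient matrix of the distance matrix of $G$ over $\pi_2$: $$P=P(m,d,c)=\begin{pmatrix} 0&2m-2&d&3m-3d\\ 2&2m-4&3d-2c&3m-5d+2c\\ 1&3m-2d-1&2d-2&2m-2d\\ 3&3m-2d-3&2d&2m-2d-2 \end{pmatrix}.$$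
   Context: All graphs are finite, simple and undirected. A design graph with parameters $(m,d,c)$, $c\neq 0$, is a $d$-regular bipartite graph of order $2m$ (so each part has $m$ vertices) in which any two distinct vertices of the same part have exactly $c$ common neighbors; the complete bipartite graph $K_{n,n}$ is excluded by convention. Let $d(u,w)$ denote graph distance. A partition $\Pi=\{V'_1,\dots,V'_k\}$ of the vertex set is a distance equitable partition if for all $i,j$ the sum $\sum_{w\in V'_j} d(u,w)$ is the same for every $u\in V'_i$; the quotient matrix of the distance matrix over $\Pi$ is the $k\times k$ matrix with $(i,j)$ entry $p_{ij}=\sum_{w\in V'_j} d(u,w)$ for any fixed $u\in V'_i$. -}

module Defs where

open import Data.Nat using (ℕ; zero; suc; _≤_)
open import Data.Bool using (Bool; true; false; if_then_else_)
open import Data.Fin using (Fin; zero; suc; _≟_)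
open import Data.Integer using (ℤ; +_; _+_; _-_; _*_)
open import Data.Product using (_×_)
open import Relation.Binary.PropositionalEquality using (_≡_; _≢_)
open import Relation.Nullary using (¬_)
open import Relation.Nullary.Decidable using (⌊_⌋)

sumFin : ∀ {n} → (Fin n → ℕ) → ℕ
sumFin {zero}  f = 0
sumFin {suc n} f = f zero Data.Nat.+ sumFin (λ i → f (suc i))

count : ∀ {n} → (Fin n → Bool) → ℕ
count p = sumFin (λ i → if p i then 1 else 0)

record Graph (n : ℕ) : Set where
  field
    adj   : Fin n → Fin n → Bool
    sym   : ∀ u w → adj u w ≡ adj w u
    irrefl : ∀ u → adj u u ≡ false
open Graph public

data Walk {n} (G : Graph n) : Fin n → Fin n → ℕ → Set where
  here : ∀ {u} → Walk G u u 0
  step : ∀ {u x w k} → adj G u x ≡ true → Walk G x w k → Walk G u w (suc k)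

IsDistance : ∀ {n} → Graph n → (Fin n → Fin n → ℕ) → Set
IsDistance G δ = ∀ u w → Walk G u w (δ u w) × (∀ k → Walk G u w k → δ u w ≤ k)

degree : ∀ {n} → Graph n → Fin n → ℕ
degree G u = count (adj G u)

commonNeighbours : ∀ {n} → Graph n → Fin n → Fin n → ℕ
commonNeighbours G u w = count (λ x → Data.Bool._∧_ (adj G u x) (adj G w x))

-- G is a design graph with parameters (m,d,c) w.r.t. the bipartition given by
-- `part` (part u ≡ true  ⇔  u ∈ V₁; part u ≡ false ⇔ u ∈ V₂).
record IsDesignGraph {n} (G : Graph n) (part : Fin n → Bool) (m d c : ℕ) : Set where
  field
    bipartite   : ∀ u w → adj G u w ≡ true → part u ≢ part w
    sizeV₁      : count part ≡ m
    sizeV₂      : count (λ u → Data.Bool.not (part u)) ≡ m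
    regular     : ∀ u → degree G u ≡ d
    common      : ∀ u w → u ≢ w → part u ≡ part w → commonNeighbours G u w ≡ c
    c≢0         : c ≢ 0
    notComplete : ¬ (∀ u w → part u ≢ part w → adj G u w ≡ true)

-- The partition π₂ = {O₁ = {v}, O₂ = V₁∖{v}, O₃ = N(v), O₄ = V₂∖N(v)},
-- given as a class function into Fin 4 (zero ↦ O₁, …, 3 ↦ O₄).
π₂ : ∀ {n} → Graph n → (Fin n → Bool) → Fin n → Fin n → Fin 4
π₂ G part v u =
  if ⌊ u ≟ v ⌋ then zero
  else if part u then suc zero
  else if adj G v u then suc (suc zero)
  else suc (suc (suc zero))

IsDistEquitableWithQuotient : ∀ {n k} → (Fin n → Fin n → ℕ) → (Fin n → Fin k) → (Fin k → Fin k → ℤ) → Set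
IsDistEquitableWithQuotient {n} {k} δ cls P =
  ∀ (i j : Fin k) (u : Fin n) → cls u ≡ i →
    + sumFin (λ w → if ⌊ cls w ≟ j ⌋ then δ u w else 0) ≡ P i j

P : ℕ → ℕ → ℕ → Fin 4 → Fin 4 → ℤ
P m d c i j = row i j
  where
  M D C : ℤ
  M = + m
  D = + d
  C = + c
  row : Fin 4 → Fin 4 → ℤ
  row zero zero = + 0
  row zero (suc zero) = + 2 * M - + 2
  row zero (suc (suc zero)) = D
  row zero (suc (suc (suc zero))) = + 3 * M - + 3 * D
  row (suc zero) zero = + 2
  row (suc zero) (suc zero) = + 2 * M - + 4
  row (suc zero) (suc (suc zero)) = + 3 * D - + 2 * C
  row (suc zero) (suc (suc (suc zero))) = + 3 * M - + 5 * D + + 2 * C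
  row (suc (suc zero)) zero = + 1
  row (suc (suc zero)) (suc zero) = + 3 * M - + 2 * D - + 1
  row (suc (suc zero)) (suc (suc zero)) = + 2 * D - + 2
  row (suc (suc zero)) (suc (suc (suc zero))) = + 2 * M - + 2 * D
  row (suc (suc (suc zero))) zero = + 3
  row (suc (suc (suc zero))) (suc zero) = + 3 * M - + 2 * D - + 3
  row (suc (suc (suc zero))) (suc (suc zero)) = + 2 * D
  row (suc (suc (suc zero))) (suc (suc (suc zero))) = + 2 * M - + 2 * D - + 2

-- Any two vertices on the same side of a design graph have c ≥ 1 common
-- neighbours, so the distance from u is 0 to u itself, 2 to the other vertices
-- on its side, 1 to its neighbours and 3 to the remaining vertices. Summing over
-- a class O_j therefore gives 2|O_j| − 2[u ∈ O_j] when O_j lies on u's side and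
-- 3|O_j| − 2|N(u) ∩ O_j| otherwise, and what remains is counting: the class sizes
-- are 1, m − 1, d, m − d, and |N(u) ∩ O_j| follows from d-regularity, from
-- |N(u) ∩ N(v)| = c for u ∈ O₂, and from whether u is adjacent to v.
module Submission where

open import Defs hiding (sym)
import Data.Nat as ℕ
open import Data.Nat using (ℕ; zero; suc; _+_; _*_; _<_; z≤n; s≤s)
open import Data.Nat.Properties
  using (≤-antisym; ≮⇒≥; +-comm; +-identityʳ; *-zeroʳ; *-identityʳ; +-0-commutativeMonoid; +-*-semiring)
open import Algebra.Properties.CommutativeMonoid.Sum +-0-commutativeMonoid
  using (sum; sum-cong-≗; sum-replicate-zero; ∑-distrib-+; ∑-comm)
open import Algebra.Properties.Semiring.Sum +-*-semiring using (*-distribˡ-sum)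
open import Data.Bool using (Bool; true; false; if_then_else_; _∧_; not)
open import Data.Bool.Properties using (¬-not; ∧-zeroʳ; ∧-identityʳ; ∧-conicalˡ; ∧-conicalʳ)
open import Data.Fin using (Fin; zero; suc; _≟_)
open import Data.Fin.Patterns using (0F; 1F; 2F; 3F)
import Data.Integer as ℤ
open import Data.Integer using (+_)
open import Data.Integer.Properties using (pos-+; pos-*)
open import Data.Integer.Tactic.RingSolver using (solve-∀)
open import Data.Product using (_×_; _,_; proj₁; proj₂; ∃-syntax)
open import Function using (_∘_)
open import Relation.Nullary using (¬_; yes; no; contradiction)
open import Relation.Nullary.Decidable using (⌊_⌋)
open import Relation.Binary.PropositionalEquality
  using (_≡_; _≢_; refl; sym; trans; cong; cong₂; ≢-sym; module ≡-Reasoning)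

open ≡-Reasoning

𝟙 : Bool → ℕ
𝟙 b = if b then 1 else 0

true≢false : true ≢ false
true≢false ()

bool-≢⇒≡ : ∀ {a b c : Bool} → a ≢ b → c ≢ b → a ≡ c
bool-≢⇒≡ a≢b c≢b = trans (¬-not a≢b) (sym (¬-not c≢b))

𝟙-∧-true : ∀ {x y} → y ≡ true → 𝟙 (x ∧ y) ≡ 𝟙 x
𝟙-∧-true {x} refl = cong 𝟙 (∧-identityʳ x)

𝟙-∧-false : ∀ {x y} → y ≡ false → 𝟙 (x ∧ y) ≡ 0
𝟙-∧-false {x} refl = cong 𝟙 (∧-zeroʳ x)

m+n≡o⇒+m≡+o-+n : ∀ {m n o} → m + n ≡ o → + m ≡ + o ℤ.- + n
m+n≡o⇒+m≡+o-+n {m} {n} refl = trans (cancel (+ m) (+ n)) (cong (ℤ._- + n) (sym (pos-+ m n)))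
  where
  cancel : ∀ x y → x ≡ x ℤ.+ y ℤ.- y
  cancel = solve-∀

sumFin≡sum : ∀ {n} (f : Fin n → ℕ) → sumFin f ≡ sum f
sumFin≡sum {zero}  f = refl
sumFin≡sum {suc n} f = cong (f zero ℕ.+_) (sumFin≡sum (f ∘ suc))

-- Not definitional: ⌊_⌋ is stuck on the map′ in the suc case of Fin's _≟_.
⌊suc≟suc⌋ : ∀ {n} (i j : Fin n) → ⌊ suc i ≟ suc j ⌋ ≡ ⌊ i ≟ j ⌋
⌊suc≟suc⌋ i j with i ≟ j
... | yes _ = refl
... | no _  = refl

sum-indicator : ∀ {n} (i : Fin n) x → sum (λ j → if ⌊ i ≟ j ⌋ then x else 0) ≡ x
sum-indicator {suc n} zero    x = trans (cong (x ℕ.+_) (sum-replicate-zero n)) (+-identityʳ x)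
sum-indicator {suc n} (suc i) x =
  trans (sum-cong-≗ (λ j → cong (λ b → if b then x else 0) (⌊suc≟suc⌋ i j))) (sum-indicator i x)

count-witness : ∀ {n} (p : Fin n → Bool) → count p ≢ 0 → ∃[ i ] p i ≡ true
count-witness {zero}  p count≢0 = contradiction refl count≢0
count-witness {suc n} p count≢0 with p zero in p0
... | true  = zero , p0
... | false with count-witness (p ∘ suc) count≢0
...   | i , pi = suc i , pi

module ClassSum {n k} (cls : Fin n → Fin k) where

  restrict : Fin k → (Fin n → ℕ) → Fin n → ℕ
  restrict j f w = if ⌊ cls w ≟ j ⌋ then f w else 0

  classSum : Fin k → (Fin n → ℕ) → ℕ
  classSum j f = sum (restrict j f)

  classSize : Fin k → ℕ
  classSize j = classSum j (λ _ → 1)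

  classSum-cong : ∀ {j f g} → (∀ w → cls w ≡ j → f w ≡ g w) → classSum j f ≡ classSum j g
  classSum-cong {j} {f} {g} f≗g = sum-cong-≗ pointwise
    where
    pointwise : ∀ w → restrict j f w ≡ restrict j g w
    pointwise w with cls w ≟ j
    ... | yes w∈j = f≗g w w∈j
    ... | no _    = refl

  classSum-zero : ∀ {j f} → (∀ w → cls w ≡ j → f w ≡ 0) → classSum j f ≡ 0
  classSum-zero {j} {f} f≗0 = trans (sum-cong-≗ pointwise) (sum-replicate-zero n)
    where
    pointwise : ∀ w → restrict j f w ≡ 0
    pointwise w with cls w ≟ j
    ... | yes w∈j = f≗0 w w∈j
    ... | no _    = refl

  classSum-affine : ∀ {j f g} a b → (∀ w → cls w ≡ j → f w + a * g w ≡ b) →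
                    classSum j f + a * classSum j g ≡ b * classSize j
  classSum-affine {j} {f} {g} a b affine = begin
    classSum j f + a * classSum j g
      ≡⟨ cong (classSum j f ℕ.+_) (*-distribˡ-sum a (restrict j g)) ⟩
    classSum j f + sum (λ w → a * restrict j g w)
      ≡⟨ ∑-distrib-+ (restrict j f) (λ w → a * restrict j g w) ⟨
    sum (λ w → restrict j f w + a * restrict j g w)
      ≡⟨ sum-cong-≗ pointwise ⟩
    sum (λ w → b * restrict j (λ _ → 1) w)
      ≡⟨ *-distribˡ-sum b (restrict j (λ _ → 1)) ⟨
    b * classSize j ∎
    where
    pointwise : ∀ w → restrict j f w + a * restrict j g w ≡ b * restrict j (λ _ → 1) w
    pointwise w with cls w ≟ j
    ... | yes w∈j = trans (affine w w∈j) (sym (*-identityʳ b))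
    ... | no _    = trans (*-zeroʳ a) (sym (*-zeroʳ b))

  classSum-indicator : ∀ j u → classSum j (λ w → 𝟙 ⌊ u ≟ w ⌋) ≡ 𝟙 ⌊ cls u ≟ j ⌋
  classSum-indicator j u = trans (sum-cong-≗ pointwise) (sum-indicator u _)
    where
    pointwise : ∀ w → restrict j (λ w → 𝟙 ⌊ u ≟ w ⌋) w ≡ (if ⌊ u ≟ w ⌋ then 𝟙 ⌊ cls u ≟ j ⌋ else 0)
    pointwise w with u ≟ w
    ... | yes refl = refl
    ... | no _ with cls w ≟ j
    ...   | yes _ = refl
    ...   | no _  = refl

  sum-over-classes : ∀ f → sum f ≡ sum (λ j → classSum j f)
  sum-over-classes f = begin
    sum f
      ≡⟨ sum-cong-≗ (λ w → sym (sum-indicator (cls w) (f w))) ⟩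
    sum (λ w → sum (λ j → restrict j f w))
      ≡⟨ ∑-comm (λ w j → restrict j f w) ⟩
    sum (λ j → classSum j f) ∎

module Walks {n} (G : Graph n) where

  adj-sym : ∀ {u w} → adj G u w ≡ true → adj G w u ≡ true
  adj-sym {u} {w} uw = trans (Graph.sym G w u) uw

  adj⇒≢ : ∀ {u w} → adj G u w ≡ true → u ≢ w
  adj⇒≢ {u} uu refl = true≢false (trans (sym uu) (irrefl G u))

  walk-zero : ∀ {u w} → Walk G u w 0 → u ≡ w
  walk-zero here = refl

  walk-one : ∀ {u w} → Walk G u w 1 → adj G u w ≡ true
  walk-one (step uw here) = uw

  walk-first-edge : ∀ {u w k} → Walk G u w k → u ≢ w → ∃[ x ] adj G u x ≡ true
  walk-first-edge here        u≢u = contradiction refl u≢u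
  walk-first-edge (step ux _) _   = _ , ux

module Distance {n} (G : Graph n) (part : Fin n → Bool)
  (bipartite : ∀ u w → adj G u w ≡ true → part u ≢ part w)
  (common-neighbour : ∀ u w → u ≢ w → part u ≡ part w → ∃[ x ] adj G u x ≡ true × adj G w x ≡ true)
  {δ : Fin n → Fin n → ℕ} (isDistance : IsDistance G δ) where

  open Walks G

  sameSide⇒nonadjacent : ∀ {u w} → part u ≡ part w → adj G u w ≡ false
  sameSide⇒nonadjacent {u} {w} same with adj G u w in uw
  ... | true  = contradiction same (bipartite u w uw)
  ... | false = refl

  walk-two : ∀ {u w} → Walk G u w 2 → part u ≡ part w
  walk-two (step {x = x} ux (step xw here)) = bool-≢⇒≡ (bipartite _ x ux) (≢-sym (bipartite x _ xw))

  δ-exact : ∀ {u w k} → Walk G u w k → (∀ {l} → l < k → ¬ Walk G u w l) → δ u w ≡ k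
  δ-exact {u} {w} W noShorter =
    ≤-antisym (proj₂ (isDistance u w) _ W) (≮⇒≥ (λ δ<k → noShorter δ<k (proj₁ (isDistance u w))))

  δ-self : ∀ {u} → δ u u ≡ 0
  δ-self = δ-exact here (λ ())

  δ-adjacent : ∀ {u w} → adj G u w ≡ true → δ u w ≡ 1
  δ-adjacent uw = δ-exact (step uw here) λ { (s≤s z≤n) W → adj⇒≢ uw (walk-zero W) }

  δ-sameSide : ∀ {u w} → u ≢ w → part u ≡ part w → δ u w ≡ 2
  δ-sameSide {u} {w} u≢w same with common-neighbour u w u≢w same
  ... | x , ux , wx = δ-exact (step ux (step (adj-sym wx) here)) noShorter
    where
    noShorter : ∀ {l} → l < 2 → ¬ Walk G u w l
    noShorter (s≤s z≤n)       W = u≢w (walk-zero W)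
    noShorter (s≤s (s≤s z≤n)) W = bipartite u w (walk-one W) same

  -- The neighbour y of w comes from a walk from w to u; u and y lie on the
  -- same side, so a common neighbour x of theirs gives the walk u x y w.
  δ-otherSide : ∀ {u w} → part u ≢ part w → adj G u w ≡ false → δ u w ≡ 3
  δ-otherSide {u} {w} sides uw≡false with walk-first-edge (proj₁ (isDistance w u)) (sides ∘ cong part ∘ sym)
  ... | y , wy with common-neighbour u y u≢y (bool-≢⇒≡ sides (≢-sym (bipartite w y wy)))
    where
    u≢y : u ≢ y
    u≢y refl = true≢false (trans (sym (adj-sym wy)) uw≡false)
  ... | x , ux , yx = δ-exact (step ux (step (adj-sym yx) (step (adj-sym wy) here))) noShorter
    where
    noShorter : ∀ {l} → l < 3 → ¬ Walk G u w l
    noShorter (s≤s z≤n)             W = sides (cong part (walk-zero W))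
    noShorter (s≤s (s≤s z≤n))       W = true≢false (trans (sym (walk-one W)) uw≡false)
    noShorter (s≤s (s≤s (s≤s z≤n))) W = sides (walk-two W)

  δ-sameSide-formula : ∀ {u w} → part u ≡ part w → δ u w + 2 * 𝟙 ⌊ u ≟ w ⌋ ≡ 2
  δ-sameSide-formula {u} {w} same with u ≟ w
  ... | yes refl = cong (_+ 2) δ-self
  ... | no u≢w   = cong (_+ 0) (δ-sameSide u≢w same)

  δ-otherSide-formula : ∀ {u w} → part u ≢ part w → δ u w + 2 * 𝟙 (adj G u w) ≡ 3
  δ-otherSide-formula {u} {w} sides with adj G u w in uw
  ... | true  = cong (_+ 2) (δ-adjacent uw)
  ... | false = cong (_+ 0) (δ-otherSide sides uw)

  module OnClasses {k} (cls : Fin n → Fin k) (side : Fin k → Bool) (part≡side : ∀ w → part w ≡ side (cls w)) where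

    open ClassSum cls

    side-of : ∀ w {j} → cls w ≡ j → part w ≡ side j
    side-of w w∈j = trans (part≡side w) (cong side w∈j)

    distanceSum-sameSide : ∀ {u j} → part u ≡ side j →
                           classSum j (δ u) + 2 * 𝟙 ⌊ cls u ≟ j ⌋ ≡ 2 * classSize j
    distanceSum-sameSide {u} {j} same = begin
      classSum j (δ u) + 2 * 𝟙 ⌊ cls u ≟ j ⌋
        ≡⟨ cong (λ t → classSum j (δ u) + 2 * t) (classSum-indicator j u) ⟨
      classSum j (δ u) + 2 * classSum j (λ w → 𝟙 ⌊ u ≟ w ⌋)
        ≡⟨ classSum-affine 2 2 (λ w w∈j → δ-sameSide-formula (trans same (sym (side-of w w∈j)))) ⟩
      2 * classSize j ∎

    distanceSum-otherSide : ∀ {u j} → part u ≢ side j →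
                            classSum j (δ u) + 2 * classSum j (𝟙 ∘ adj G u) ≡ 3 * classSize j
    distanceSum-otherSide sides =
      classSum-affine 2 3 (λ w w∈j → δ-otherSide-formula (λ eq → sides (trans eq (side-of w w∈j))))

design-common-neighbour : ∀ {n} {G : Graph n} {part m d c} → IsDesignGraph G part m d c →
  ∀ u w → u ≢ w → part u ≡ part w → ∃[ x ] adj G u x ≡ true × adj G w x ≡ true
design-common-neighbour {G = G} design u w u≢w same
  with count-witness (λ x → adj G u x ∧ adj G w x) (λ none → c≢0 (trans (sym (common u w u≢w same)) none))
  where open IsDesignGraph design
... | x , both = x , ∧-conicalˡ _ _ both , ∧-conicalʳ _ _ both

module Quotient {n} {G : Graph n} {part : Fin n → Bool} {m d c : ℕ} (design : IsDesignGraph G part m d c)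
  {δ : Fin n → Fin n → ℕ} (isDistance : IsDistance G δ) {v : Fin n} (v∈V₁ : part v ≡ true) where

  open IsDesignGraph design
  open Distance G part bipartite (design-common-neighbour design) isDistance

  cls : Fin n → Fin 4
  cls = π₂ G part v

  open ClassSum cls

  side : Fin 4 → Bool
  side 0F = true
  side 1F = true
  side 2F = false
  side 3F = false

  part≡side : ∀ w → part w ≡ side (cls w)
  part≡side w with w ≟ v
  ... | yes refl = v∈V₁
  ... | no _ with part w
  ...   | true  = refl
  ...   | false with adj G v w
  ...     | true  = refl
  ...     | false = refl

  open OnClasses cls side part≡side

  v∈O₁ : cls v ≡ 0F
  v∈O₁ with v ≟ v
  ... | yes _  = refl
  ... | no v≢v = contradiction refl v≢v

  ∈O₁⇒≡v : ∀ w → cls w ≡ 0F → w ≡ v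
  ∈O₁⇒≡v w with w ≟ v | part w | adj G v w
  ... | yes w≡v | _     | _     = λ _ → w≡v
  ... | no _    | true  | _     = λ ()
  ... | no _    | false | true  = λ ()
  ... | no _    | false | false = λ ()

  ∈O₃⇒adjacent : ∀ w → cls w ≡ 2F → adj G v w ≡ true
  ∈O₃⇒adjacent w with w ≟ v | part w | adj G v w
  ... | yes _ | _     | _     = λ ()
  ... | no _  | true  | _     = λ ()
  ... | no _  | false | true  = λ _ → refl
  ... | no _  | false | false = λ ()

  ∈O₄⇒nonadjacent : ∀ w → cls w ≡ 3F → adj G v w ≡ false
  ∈O₄⇒nonadjacent w with w ≟ v | part w | adj G v w
  ... | yes _ | _     | _     = λ ()
  ... | no _  | true  | _     = λ ()
  ... | no _  | false | true  = λ ()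
  ... | no _  | false | false = λ _ → refl

  classSum-O₁ : ∀ f → classSum 0F f ≡ f v
  classSum-O₁ f = trans (sum-cong-≗ pointwise) (sum-indicator v (f v))
    where
    pointwise : ∀ w → restrict 0F f w ≡ (if ⌊ v ≟ w ⌋ then f v else 0)
    pointwise w with v ≟ w
    ... | yes refl rewrite v∈O₁ = refl
    ... | no v≢w with cls w ≟ 0F
    ...   | yes w∈O₁ = contradiction (sym (∈O₁⇒≡v w w∈O₁)) v≢w
    ...   | no _     = refl

  sum-V₁ : ∀ {f} → (∀ w → part w ≡ false → f w ≡ 0) → sum f ≡ classSum 0F f + classSum 1F f
  sum-V₁ {f} vanish = begin
    sum f
      ≡⟨ sum-over-classes f ⟩
    classSum 0F f + (classSum 1F f + (classSum 2F f + (classSum 3F f + 0)))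
      ≡⟨ cong (λ t → classSum 0F f + (classSum 1F f + t)) (cong₂ (λ a b → a + (b + 0)) (onV₂ 2F refl) (onV₂ 3F refl)) ⟩
    classSum 0F f + (classSum 1F f + 0)
      ≡⟨ cong (classSum 0F f ℕ.+_) (+-identityʳ _) ⟩
    classSum 0F f + classSum 1F f ∎
    where
    onV₂ : ∀ j → side j ≡ false → classSum j f ≡ 0
    onV₂ j sj = classSum-zero (λ w w∈j → vanish w (trans (side-of w w∈j) sj))

  sum-V₂ : ∀ {f} → (∀ w → part w ≡ true → f w ≡ 0) → sum f ≡ classSum 2F f + classSum 3F f
  sum-V₂ {f} vanish = begin
    sum f
      ≡⟨ sum-over-classes f ⟩
    classSum 0F f + (classSum 1F f + (classSum 2F f + (classSum 3F f + 0)))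
      ≡⟨ cong₂ (λ a b → a + (b + (classSum 2F f + (classSum 3F f + 0)))) (onV₁ 0F refl) (onV₁ 1F refl) ⟩
    classSum 2F f + (classSum 3F f + 0)
      ≡⟨ cong (classSum 2F f ℕ.+_) (+-identityʳ _) ⟩
    classSum 2F f + classSum 3F f ∎
    where
    onV₁ : ∀ j → side j ≡ true → classSum j f ≡ 0
    onV₁ j sj = classSum-zero (λ w w∈j → vanish w (trans (side-of w w∈j) sj))

  |O₁|≡1 : classSize 0F ≡ 1
  |O₁|≡1 = classSum-O₁ _

  |O₁|+|O₂|≡m : classSize 0F + classSize 1F ≡ m
  |O₁|+|O₂|≡m = begin
    classSize 0F + classSize 1F
      ≡⟨ cong₂ _+_ (classSum-cong (onV₁ refl)) (classSum-cong (onV₁ refl)) ⟩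
    classSum 0F (𝟙 ∘ part) + classSum 1F (𝟙 ∘ part)
      ≡⟨ sum-V₁ (λ _ → cong 𝟙) ⟨
    sum (𝟙 ∘ part)
      ≡⟨ sumFin≡sum (𝟙 ∘ part) ⟨
    count part
      ≡⟨ sizeV₁ ⟩
    m ∎
    where
    onV₁ : ∀ {j} → side j ≡ true → ∀ w → cls w ≡ j → 1 ≡ 𝟙 (part w)
    onV₁ sj w w∈j = cong 𝟙 (sym (trans (side-of w w∈j) sj))

  |O₃|+|O₄|≡m : classSize 2F + classSize 3F ≡ m
  |O₃|+|O₄|≡m = begin
    classSize 2F + classSize 3F
      ≡⟨ cong₂ _+_ (classSum-cong (onV₂ refl)) (classSum-cong (onV₂ refl)) ⟩
    classSum 2F (𝟙 ∘ not ∘ part) + classSum 3F (𝟙 ∘ not ∘ part)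
      ≡⟨ sum-V₂ (λ _ → cong (𝟙 ∘ not)) ⟨
    sum (𝟙 ∘ not ∘ part)
      ≡⟨ sumFin≡sum (𝟙 ∘ not ∘ part) ⟨
    count (not ∘ part)
      ≡⟨ sizeV₂ ⟩
    m ∎
    where
    onV₂ : ∀ {j} → side j ≡ false → ∀ w → cls w ≡ j → 1 ≡ 𝟙 (not (part w))
    onV₂ sj w w∈j = cong (𝟙 ∘ not) (sym (trans (side-of w w∈j) sj))

  degreeIn : Fin n → Fin 4 → ℕ
  degreeIn u j = classSum j (𝟙 ∘ adj G u)

  degreeIn-V₁ : ∀ u → part u ≡ true → degreeIn u 2F + degreeIn u 3F ≡ d
  degreeIn-V₁ u u∈V₁ = begin
    degreeIn u 2F + degreeIn u 3F
      ≡⟨ sum-V₂ (λ w w∈V₁ → cong 𝟙 (sameSide⇒nonadjacent (trans u∈V₁ (sym w∈V₁)))) ⟨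
    sum (𝟙 ∘ adj G u)
      ≡⟨ sumFin≡sum (𝟙 ∘ adj G u) ⟨
    degree G u
      ≡⟨ regular u ⟩
    d ∎

  degreeIn-V₂ : ∀ u → part u ≡ false → degreeIn u 0F + degreeIn u 1F ≡ d
  degreeIn-V₂ u u∈V₂ = begin
    degreeIn u 0F + degreeIn u 1F
      ≡⟨ sum-V₁ (λ w w∈V₂ → cong 𝟙 (sameSide⇒nonadjacent (trans u∈V₂ (sym w∈V₂)))) ⟨
    sum (𝟙 ∘ adj G u)
      ≡⟨ sumFin≡sum (𝟙 ∘ adj G u) ⟨
    degree G u
      ≡⟨ regular u ⟩
    d ∎

  degreeIn-O₁ : ∀ u → degreeIn u 0F ≡ 𝟙 (adj G v u)
  degreeIn-O₁ u = trans (classSum-O₁ _) (cong 𝟙 (Graph.sym G u v))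

  degreeIn-O₁-O₄ : ∀ u → cls u ≡ 0F → degreeIn u 3F ≡ 0
  degreeIn-O₁-O₄ u u∈O₁ with refl ← ∈O₁⇒≡v u u∈O₁ =
    classSum-zero (λ w → cong 𝟙 ∘ ∈O₄⇒nonadjacent w)

  degreeIn-O₁-O₃ : ∀ u → cls u ≡ 0F → degreeIn u 2F ≡ d
  degreeIn-O₁-O₃ u u∈O₁ = begin
    degreeIn u 2F                  ≡⟨ +-identityʳ _ ⟨
    degreeIn u 2F + 0              ≡⟨ cong (degreeIn u 2F ℕ.+_) (degreeIn-O₁-O₄ u u∈O₁) ⟨
    degreeIn u 2F + degreeIn u 3F  ≡⟨ degreeIn-V₁ u (side-of u u∈O₁) ⟩
    d                              ∎

  -- The common neighbours of u and v are exactly the neighbours of u in N(v) = O₃.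
  degreeIn-O₂-O₃ : ∀ u → cls u ≡ 1F → degreeIn u 2F ≡ c
  degreeIn-O₂-O₃ u u∈O₂ = begin
    degreeIn u 2F
      ≡⟨ +-identityʳ _ ⟨
    degreeIn u 2F + 0
      ≡⟨ cong₂ _+_ (classSum-cong (λ w → sym ∘ 𝟙-∧-true ∘ ∈O₃⇒adjacent w))
                   (sym (classSum-zero (λ w → 𝟙-∧-false ∘ ∈O₄⇒nonadjacent w))) ⟩
    classSum 2F both + classSum 3F both
      ≡⟨ sum-V₂ (λ w w∈V₁ → 𝟙-∧-false (sameSide⇒nonadjacent (trans v∈V₁ (sym w∈V₁)))) ⟨
    sum both
      ≡⟨ sumFin≡sum both ⟨
    commonNeighbours G u v
      ≡⟨ common u v u≢v (trans (side-of u u∈O₂) (sym v∈V₁)) ⟩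
    c ∎
    where
    both : Fin n → ℕ
    both w = 𝟙 (adj G u w ∧ adj G v w)
    u≢v : u ≢ v
    u≢v refl with trans (sym v∈O₁) u∈O₂
    ... | ()

  degreeIn-O₃-O₁ : ∀ u → cls u ≡ 2F → degreeIn u 0F ≡ 1
  degreeIn-O₃-O₁ u u∈O₃ = trans (degreeIn-O₁ u) (cong 𝟙 (∈O₃⇒adjacent u u∈O₃))

  degreeIn-O₄-O₁ : ∀ u → cls u ≡ 3F → degreeIn u 0F ≡ 0
  degreeIn-O₄-O₁ u u∈O₄ = trans (degreeIn-O₁ u) (cong 𝟙 (∈O₄⇒nonadjacent u u∈O₄))

  degreeIn-O₄-O₂ : ∀ u → cls u ≡ 3F → degreeIn u 1F ≡ d
  degreeIn-O₄-O₂ u u∈O₄ =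
    trans (cong (_+ degreeIn u 1F) (sym (degreeIn-O₄-O₁ u u∈O₄))) (degreeIn-V₂ u (side-of u u∈O₄))

  |O₃|≡d : classSize 2F ≡ d
  |O₃|≡d = trans (classSum-cong (λ w → cong 𝟙 ∘ sym ∘ ∈O₃⇒adjacent w)) (degreeIn-O₁-O₃ v v∈O₁)

  |O₂|≡m-1 : + classSize 1F ≡ + m ℤ.- + 1
  |O₂|≡m-1 = trans (m+n≡o⇒+m≡+o-+n (trans (+-comm (classSize 1F) (classSize 0F)) |O₁|+|O₂|≡m)) (cong (λ t → + m ℤ.- + t) |O₁|≡1)

  |O₄|≡m-d : + classSize 3F ≡ + m ℤ.- + d
  |O₄|≡m-d = trans (m+n≡o⇒+m≡+o-+n (trans (+-comm (classSize 3F) (classSize 2F)) |O₃|+|O₄|≡m)) (cong (λ t → + m ℤ.- + t) |O₃|≡d)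

  degreeIn-O₂-O₄ : ∀ u → cls u ≡ 1F → + degreeIn u 3F ≡ + d ℤ.- + c
  degreeIn-O₂-O₄ u u∈O₂ =
    trans (m+n≡o⇒+m≡+o-+n (trans (+-comm (degreeIn u 3F) (degreeIn u 2F)) (degreeIn-V₁ u (side-of u u∈O₂))))
          (cong (λ t → + d ℤ.- + t) (degreeIn-O₂-O₃ u u∈O₂))

  degreeIn-O₃-O₂ : ∀ u → cls u ≡ 2F → + degreeIn u 1F ≡ + d ℤ.- + 1
  degreeIn-O₃-O₂ u u∈O₃ =
    trans (m+n≡o⇒+m≡+o-+n (trans (+-comm (degreeIn u 1F) (degreeIn u 0F)) (degreeIn-V₂ u (side-of u u∈O₃))))
          (cong (λ t → + d ℤ.- + t) (degreeIn-O₃-O₁ u u∈O₃))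

  distanceSum : Fin n → Fin 4 → ℕ
  distanceSum u j = classSum j (δ u)

  viaSameSide : ∀ {i j s p} u → cls u ≡ i → side i ≡ side j → + classSize j ≡ s →
                + 2 ℤ.* s ℤ.- + 2 ℤ.* + 𝟙 ⌊ i ≟ j ⌋ ≡ p → + distanceSum u j ≡ p
  viaSameSide {i} {j} {s} {p} u u∈i same size arith = begin
    + distanceSum u j
      ≡⟨ m+n≡o⇒+m≡+o-+n (distanceSum-sameSide (trans (side-of u u∈i) same)) ⟩
    + (2 * classSize j) ℤ.- + (2 * 𝟙 ⌊ cls u ≟ j ⌋)
      ≡⟨ cong₂ ℤ._-_ (pos-* 2 (classSize j)) (pos-* 2 (𝟙 ⌊ cls u ≟ j ⌋)) ⟩
    + 2 ℤ.* + classSize j ℤ.- + 2 ℤ.* + 𝟙 ⌊ cls u ≟ j ⌋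
      ≡⟨ cong₂ (λ t k → + 2 ℤ.* t ℤ.- + 2 ℤ.* + 𝟙 ⌊ k ≟ j ⌋) size u∈i ⟩
    + 2 ℤ.* s ℤ.- + 2 ℤ.* + 𝟙 ⌊ i ≟ j ⌋
      ≡⟨ arith ⟩
    p ∎

  viaOtherSide : ∀ {i j s a p} u → cls u ≡ i → side i ≢ side j → + classSize j ≡ s → + degreeIn u j ≡ a →
                 + 3 ℤ.* s ℤ.- + 2 ℤ.* a ≡ p → + distanceSum u j ≡ p
  viaOtherSide {i} {j} {s} {a} {p} u u∈i sides size degree arith = begin
    + distanceSum u j
      ≡⟨ m+n≡o⇒+m≡+o-+n (distanceSum-otherSide (sides ∘ trans (sym (side-of u u∈i)))) ⟩
    + (3 * classSize j) ℤ.- + (2 * degreeIn u j)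
      ≡⟨ cong₂ ℤ._-_ (pos-* 3 (classSize j)) (pos-* 2 (degreeIn u j)) ⟩
    + 3 ℤ.* + classSize j ℤ.- + 2 ℤ.* + degreeIn u j
      ≡⟨ cong₂ (λ t b → + 3 ℤ.* t ℤ.- + 2 ℤ.* b) size degree ⟩
    + 3 ℤ.* s ℤ.- + 2 ℤ.* a
      ≡⟨ arith ⟩
    p ∎

  p₀₁ : ∀ M → + 2 ℤ.* (M ℤ.- + 1) ℤ.- + 2 ℤ.* + 0 ≡ + 2 ℤ.* M ℤ.- + 2
  p₀₁ = solve-∀
  p₀₂ : ∀ D → + 3 ℤ.* D ℤ.- + 2 ℤ.* D ≡ D
  p₀₂ = solve-∀
  p₀₃ : ∀ M D → + 3 ℤ.* (M ℤ.- D) ℤ.- + 2 ℤ.* + 0 ≡ + 3 ℤ.* M ℤ.- + 3 ℤ.* D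
  p₀₃ = solve-∀
  p₁₁ : ∀ M → + 2 ℤ.* (M ℤ.- + 1) ℤ.- + 2 ℤ.* + 1 ≡ + 2 ℤ.* M ℤ.- + 4
  p₁₁ = solve-∀
  p₁₃ : ∀ M D C → + 3 ℤ.* (M ℤ.- D) ℤ.- + 2 ℤ.* (D ℤ.- C) ≡ + 3 ℤ.* M ℤ.- + 5 ℤ.* D ℤ.+ + 2 ℤ.* C
  p₁₃ = solve-∀
  p₂₁ : ∀ M D → + 3 ℤ.* (M ℤ.- + 1) ℤ.- + 2 ℤ.* (D ℤ.- + 1) ≡ + 3 ℤ.* M ℤ.- + 2 ℤ.* D ℤ.- + 1
  p₂₁ = solve-∀
  p₂₃ : ∀ M D → + 2 ℤ.* (M ℤ.- D) ℤ.- + 2 ℤ.* + 0 ≡ + 2 ℤ.* M ℤ.- + 2 ℤ.* D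
  p₂₃ = solve-∀
  p₃₁ : ∀ M D → + 3 ℤ.* (M ℤ.- + 1) ℤ.- + 2 ℤ.* D ≡ + 3 ℤ.* M ℤ.- + 2 ℤ.* D ℤ.- + 3
  p₃₁ = solve-∀
  p₃₂ : ∀ D → + 2 ℤ.* D ℤ.- + 2 ℤ.* + 0 ≡ + 2 ℤ.* D
  p₃₂ = solve-∀
  p₃₃ : ∀ M D → + 2 ℤ.* (M ℤ.- D) ℤ.- + 2 ℤ.* + 1 ≡ + 2 ℤ.* M ℤ.- + 2 ℤ.* D ℤ.- + 2
  p₃₃ = solve-∀

  quotient : ∀ i j u → cls u ≡ i → + distanceSum u j ≡ P m d c i j
  quotient 0F 0F u u∈ = viaSameSide  u u∈ refl   (cong +_ |O₁|≡1) refl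
  quotient 0F 1F u u∈ = viaSameSide  u u∈ refl   |O₂|≡m-1 (p₀₁ (+ m))
  quotient 0F 2F u u∈ = viaOtherSide u u∈ (λ ()) (cong +_ |O₃|≡d) (cong +_ (degreeIn-O₁-O₃ u u∈)) (p₀₂ (+ d))
  quotient 0F 3F u u∈ = viaOtherSide u u∈ (λ ()) |O₄|≡m-d (cong +_ (degreeIn-O₁-O₄ u u∈)) (p₀₃ (+ m) (+ d))
  quotient 1F 0F u u∈ = viaSameSide  u u∈ refl   (cong +_ |O₁|≡1) refl
  quotient 1F 1F u u∈ = viaSameSide  u u∈ refl   |O₂|≡m-1 (p₁₁ (+ m))
  quotient 1F 2F u u∈ = viaOtherSide u u∈ (λ ()) (cong +_ |O₃|≡d) (cong +_ (degreeIn-O₂-O₃ u u∈)) refl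
  quotient 1F 3F u u∈ = viaOtherSide u u∈ (λ ()) |O₄|≡m-d (degreeIn-O₂-O₄ u u∈) (p₁₃ (+ m) (+ d) (+ c))
  quotient 2F 0F u u∈ = viaOtherSide u u∈ (λ ()) (cong +_ |O₁|≡1) (cong +_ (degreeIn-O₃-O₁ u u∈)) refl
  quotient 2F 1F u u∈ = viaOtherSide u u∈ (λ ()) |O₂|≡m-1 (degreeIn-O₃-O₂ u u∈) (p₂₁ (+ m) (+ d))
  quotient 2F 2F u u∈ = viaSameSide  u u∈ refl   (cong +_ |O₃|≡d) refl
  quotient 2F 3F u u∈ = viaSameSide  u u∈ refl   |O₄|≡m-d (p₂₃ (+ m) (+ d))
  quotient 3F 0F u u∈ = viaOtherSide u u∈ (λ ()) (cong +_ |O₁|≡1) (cong +_ (degreeIn-O₄-O₁ u u∈)) refl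
  quotient 3F 1F u u∈ = viaOtherSide u u∈ (λ ()) |O₂|≡m-1 (cong +_ (degreeIn-O₄-O₂ u u∈)) (p₃₁ (+ m) (+ d))
  quotient 3F 2F u u∈ = viaSameSide  u u∈ refl   (cong +_ |O₃|≡d) (p₃₂ (+ d))
  quotient 3F 3F u u∈ = viaSameSide  u u∈ refl   |O₄|≡m-d (p₃₃ (+ m) (+ d))

theorem2p3 : ∀ {n} (G : Graph n) (part : Fin n → Bool) (m d c : ℕ)
    → IsDesignGraph G part m d c
    → (δ : Fin n → Fin n → ℕ) → IsDistance G δ
    → (v : Fin n) → part v ≡ true
    → IsDistEquitableWithQuotient δ (π₂ G part v) (P m d c)
theorem2p3 G part m d c design δ isDistance v v∈V₁ i j u u∈Oᵢ =
  trans (cong +_ (sumFin≡sum (ClassSum.restrict (π₂ G part v) j (δ u)))) (Quotient.quotient design isDistance v∈V₁ i j u u∈Oᵢ)
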